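{- If a graph $G$ can be obtained from a subdivision of $K_{3,3}$ by adding one edge between two (non-adjacent) vertices of it, then $G$ has a proper $K_4$-subdivision.
   Context: Graphs are finite and simple. A subdivision of a graph $H$ is obtained by replacing edges of $H$ by internally disjoint paths. $G$ has a proper $K_4$-subdivision if there is a vertex $v\in V(G)$ such that $G\setminus v$ contains a subdivision of $K_4$ as a subgraph. -}

module Defs where

open import Data.Nat using (ℕ; zero; suc; _<ᵇ_)
open import Data.Fin using (Fin; zero; suc; toℕ; punchIn; _<_; _≟_)
open import Data.Bool using (Bool; true; false; not; _xor_)
open import Data.Bool.Properties using (xor-comm; xor-same)
open import Data.List using (List; []; _∷_; _++_; [_])
open import Data.List.Membership.Propositional using (_∈_; _∉_)
open import Data.List.Relation.Unary.Linked using (Linked)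
open import Data.List.Relation.Unary.Unique.Propositional using (Unique)
open import Data.Product using (Σ; ∃; _×_; _,_)
open import Data.Sum using (_⊎_)
open import Data.Empty using (⊥; ⊥-elim)
open import Relation.Nullary using (¬_; does; yes; no)
open import Relation.Binary.PropositionalEquality using (_≡_; _≢_; refl; sym)
open import Function using (Injective)

record Graph (n : ℕ) : Set where
  field
    adj    : Fin n → Fin n → Bool
    adj-sym    : ∀ i j → adj i j ≡ adj j i
    adj-irrefl : ∀ i → adj i i ≡ false

open Graph public

Edge : ∀ {n} → Graph n → Fin n → Fin n → Set
Edge G u v = adj G u v ≡ true

K4 : Graph 4
K4 = record { adj = λ i j → not (does (i ≟ j)) ; adj-sym = s ; adj-irrefl = r }
  where
  s : ∀ (i j : Fin 4) → not (does (i ≟ j)) ≡ not (does (j ≟ i))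
  s i j with i ≟ j | j ≟ i
  ... | yes _ | yes _ = refl
  ... | no _  | no _  = refl
  ... | yes p | no q  = ⊥-elim (q (sym p))
  ... | no p  | yes q = ⊥-elim (p (sym q))
  r : ∀ (i : Fin 4) → not (does (i ≟ i)) ≡ false
  r i with i ≟ i
  ... | yes _ = refl
  ... | no q  = ⊥-elim (q refl)

-- vertices 0,1,2 form one side, 3,4,5 the other
K33 : Graph 6
K33 = record { adj = λ i j → side i xor side j
             ; adj-sym = λ i j → xor-comm (side i) (side j)
             ; adj-irrefl = λ i → xor-same (side i) }
  where
  side : Fin 6 → Bool
  side i = toℕ i <ᵇ 3

-- Topological embeddings ("G contains a subdivision of H as a subgraph").

record TopEmbedding {h n : ℕ} (H : Graph h) (G : Graph n) : Set where
  field
    branch      : Fin h → Fin n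
    branch-inj  : Injective _≡_ _≡_ branch
    inner       : Fin h → Fin h → List (Fin n)
  pathOf : Fin h → Fin h → List (Fin n)
  pathOf i j = branch i ∷ (inner i j ++ [ branch j ])
  field
    path-edges  : ∀ i j → i < j → Edge H i j → Linked (Edge G) (pathOf i j)
    path-unique : ∀ i j → i < j → Edge H i j → Unique (pathOf i j)
    inner-not-branch : ∀ i j → i < j → Edge H i j →
                       ∀ v → v ∈ inner i j → ∀ k → v ≢ branch k
    internally-disjoint : ∀ i j k l → i < j → Edge H i j → k < l → Edge H k l →
                          ¬ (i ≡ k × j ≡ l) →
                          ∀ v → v ∈ inner i j → v ∉ inner k l

open TopEmbedding public

ContainsSubdivision : ∀ {n h} → Graph n → Graph h → Set
ContainsSubdivision G H = TopEmbedding H G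

Consecutive : ∀ {n} → Fin n → Fin n → List (Fin n) → Set
Consecutive u v p = ∃ λ xs → ∃ λ ys →
  (p ≡ xs ++ (u ∷ v ∷ ys)) ⊎ (p ≡ xs ++ (v ∷ u ∷ ys))

-- S is (isomorphic to) a subdivision of H: a topological embedding of H
-- in S that uses every vertex and every edge of S.
IsSubdivisionOf : ∀ {n h} → Graph n → Graph h → Set
IsSubdivisionOf {n} {h} S H = Σ (TopEmbedding H S) λ e →
    (∀ (v : Fin n) → (∃ λ k → v ≡ branch e k)
                     ⊎ (∃ λ i → ∃ λ j → i < j × Edge H i j × v ∈ inner e i j))
  × (∀ (u v : Fin n) → Edge S u v →
       ∃ λ i → ∃ λ j → i < j × Edge H i j × Consecutive u v (pathOf e i j))

deleteVertex : ∀ {n} → Graph (suc n) → Fin (suc n) → Graph n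
deleteVertex G v = record
  { adj = λ i j → adj G (punchIn v i) (punchIn v j)
  ; adj-sym = λ i j → adj-sym G (punchIn v i) (punchIn v j)
  ; adj-irrefl = λ i → adj-irrefl G (punchIn v i) }

-- G has a proper K₄-subdivision: some v with G ∖ v containing a
-- subdivision of K₄ as a subgraph.
HasProperK4Subdivision : ∀ {n} → Graph n → Set
HasProperK4Subdivision {zero}  G = ⊥
HasProperK4Subdivision {suc n} G =
  ∃ λ (v : Fin (suc n)) → ContainsSubdivision (deleteVertex G v) K4

-- If x (say) is an inner vertex of the path of S
-- replacing an edge cd of K₃,₃ (which is also the case when x, y are the branch vertices of c, d,
-- since xy is not an edge of S), then S − x still contains a subdivision of K₃,₃ − cd, and
-- K₃,₃ − cd contains a subdivision of K₄.  Otherwise x, y are the branch vertices of two vertices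
-- p, q on the same side; then G contains a subdivision of K₃,₃ + pq, which contains a subdivision
-- of K₄ avoiding a branch vertex of the other side.  In both cases the K₄-subdivision of G is
-- obtained by composing a topological embedding of K₄ into a graph on six vertices, found by
-- inspection and checked by computation, with one of that graph into G.

module Submission where

open import Defs
import Data.Nat as ℕ
open import Data.Bool using (Bool; true; false; not; _∧_; _∨_; if_then_else_)
open import Data.Bool.Properties using (∨-comm; ∧-comm; ∧-zeroʳ) renaming (_≟_ to _≟ᵇ_)
open import Data.Empty using (⊥; ⊥-elim)
open import Data.Fin using (Fin; punchIn; punchOut; _<_; _≟_)
open import Data.Fin.Patterns using (0F; 1F; 2F; 3F; 4F; 5F)
open import Data.Fin.Properties using (<-cmp; <-asym; <-irrefl; punchIn-punchOut; _<?_; all?)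
open import Data.List using (List; []; _∷_; _++_; [_]; map; reverse; reverseAcc)
open import Data.List.Properties using (++-assoc; map-++; reverse-++; unfold-reverse)
open import Data.List.Membership.Propositional using (_∈_; _∉_)
open import Data.List.Membership.Propositional.Properties using (∈-++⁻; ∈-++⁺ˡ; ∈-++⁺ʳ)
open import Data.List.Relation.Unary.All using (All; []; _∷_)
import Data.List.Relation.Unary.All as All
import Data.List.Relation.Unary.All.Properties as All
open import Data.List.Relation.Unary.Any using (here; there)
import Data.List.Relation.Unary.Any.Properties as Any
open import Data.List.Relation.Unary.Linked using (Linked; []; [-]; _∷_)
import Data.List.Relation.Unary.Linked as Linked
import Data.List.Relation.Unary.Linked.Properties as Linked
open import Data.List.Relation.Unary.Unique.Propositional using (Unique; []; _∷_)
import Data.List.Relation.Unary.Unique.Propositional.Properties as Unique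
open import Data.List.Relation.Binary.Permutation.Propositional using (↭-sym; ↭⇒↭ₛ)
open import Data.List.Relation.Binary.Permutation.Propositional.Properties using (↭-reverse)
import Data.List.Relation.Binary.Permutation.Setoid.Properties as Perm
open import Data.Product using (∃; ∃₂; _×_; _,_; proj₁; proj₂)
open import Data.Sum using (_⊎_; inj₁; inj₂)
open import Data.Unit using (tt)
open import Function using (_∘_; case_of_)
open import Function.Bundles using (_⇔_; Equivalence)
open import Relation.Binary.Definitions using (Symmetric; tri<; tri≈; tri>)
open import Relation.Binary.PropositionalEquality
  using (_≡_; _≢_; refl; sym; trans; cong; cong₂; subst; subst₂; setoid; module ≡-Reasoning)
open import Relation.Nullary using (¬_; does; yes; no)
open import Relation.Nullary.Decidable using (Dec; dec-true; ¬?; _×-dec_; _→-dec_; toWitness)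

module _ {A : Set} where

  Linked-join : ∀ {R : A → A → Set} xs {m ys} →
                Linked R (xs ++ [ m ]) → Linked R (m ∷ ys) → Linked R (xs ++ m ∷ ys)
  Linked-join []           _         l = l
  Linked-join (_ ∷ [])     (r ∷ [-]) l = r ∷ l
  Linked-join (_ ∷ y ∷ xs) (r ∷ rs)  l = r ∷ Linked-join (y ∷ xs) rs l

  Linked-reverse : ∀ {R : A → A → Set} → Symmetric R → ∀ {xs} → Linked R xs → Linked R (reverse xs)
  Linked-reverse {R} R-sym {[]}    l = l
  Linked-reverse {R} R-sym {_ ∷ _} l = go [-] l
    where
    go : ∀ {x acc xs} → Linked R (x ∷ acc) → Linked R (x ∷ xs) → Linked R (reverseAcc (x ∷ acc) xs)
    go acc [-]     = acc
    go acc (r ∷ l) = go (R-sym r ∷ acc) l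

  Unique-reverse : ∀ {xs : List A} → Unique xs → Unique (reverse xs)
  Unique-reverse {xs} = Perm.Unique-resp-↭ (setoid A) (↭⇒↭ₛ (↭-sym (↭-reverse xs)))

  Unique-++⁻ˡ : ∀ xs {ys : List A} → Unique (xs ++ ys) → Unique xs
  Unique-++⁻ˡ []       _        = []
  Unique-++⁻ˡ (x ∷ xs) (x∉ ∷ u) = All.++⁻ˡ xs x∉ ∷ Unique-++⁻ˡ xs u

  reverse-path : ∀ (x : A) xs y → reverse (x ∷ xs ++ [ y ]) ≡ y ∷ reverse xs ++ [ x ]
  reverse-path x xs y = begin
    reverse (x ∷ xs ++ [ y ])       ≡⟨ unfold-reverse x (xs ++ [ y ]) ⟩
    reverse (xs ++ [ y ]) ++ [ x ]  ≡⟨ cong (_++ [ x ]) (reverse-++ xs [ y ]) ⟩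
    y ∷ reverse xs ++ [ x ]         ∎
    where open ≡-Reasoning

_⊆ᴳ_ : ∀ {n} → Graph n → Graph n → Set
G ⊆ᴳ G′ = ∀ u v → Edge G u v → Edge G′ u v

Edge-sym : ∀ {n} (G : Graph n) {u v} → Edge G u v → Edge G v u
Edge-sym G {u} {v} uv = trans (adj-sym G v u) uv

Edge-irrefl : ∀ {n} (G : Graph n) {u} → ¬ Edge G u u
Edge-irrefl G {u} uu with trans (sym (adj-irrefl G u)) uu
... | ()

module _ {n : ℕ.ℕ} where

  joins : Fin n → Fin n → Fin n → Fin n → Bool
  joins p q i j = does (i ≟ p) ∧ does (j ≟ q) ∨ does (i ≟ q) ∧ does (j ≟ p)

  joins-sym : ∀ p q i j → joins p q i j ≡ joins p q j i
  joins-sym p q i j = trans (∨-comm (does (i ≟ p) ∧ does (j ≟ q)) _)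
                            (cong₂ _∨_ (∧-comm (does (i ≟ q)) _) (∧-comm (does (i ≟ p)) _))

  joins⇒ : ∀ {p q i j} → joins p q i j ≡ true → (i ≡ p × j ≡ q) ⊎ (i ≡ q × j ≡ p)
  joins⇒ {p} {q} {i} {j} h with i ≟ p | j ≟ q | i ≟ q | j ≟ p
  ... | yes i≡p | yes j≡q | _       | _       = inj₁ (i≡p , j≡q)
  ... | _       | _       | yes i≡q | yes j≡p = inj₂ (i≡q , j≡p)
  joins⇒ () | yes _ | no _ | yes _ | no _
  joins⇒ () | yes _ | no _ | no _  | _
  joins⇒ () | no _  | _    | yes _ | no _
  joins⇒ () | no _  | _    | no _  | _

-- The guard keeps the graph loopless when p ≡ q.
addEdge : ∀ {n} → Graph n → Fin n → Fin n → Graph n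
addEdge H p q = record
  { adj        = λ i j → adj H i j ∨ (joins p q i j ∧ not (does (p ≟ q)))
  ; adj-sym    = λ i j → cong₂ _∨_ (adj-sym H i j) (cong (_∧ _) (joins-sym p q i j))
  ; adj-irrefl = irrefl
  }
  where
  irrefl : ∀ i → adj H i i ∨ (joins p q i i ∧ not (does (p ≟ q))) ≡ false
  irrefl i rewrite adj-irrefl H i with i ≟ p | i ≟ q | p ≟ q
  ... | _        | _        | yes _ = ∧-zeroʳ _
  ... | yes refl | yes refl | no p≢p = ⊥-elim (p≢p refl)
  ... | yes _    | no _     | no _  = refl
  ... | no _     | yes _    | no _  = refl
  ... | no _     | no _     | no _  = refl

addEdge-edge : ∀ {n} (H : Graph n) p q {i j} → Edge (addEdge H p q) i j →
               Edge H i j ⊎ ((i ≡ p × j ≡ q) ⊎ (i ≡ q × j ≡ p))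
addEdge-edge H p q {i} {j} h with adj H i j | joins p q i j in jn
... | true  | _    = inj₁ refl
... | false | true = inj₂ (joins⇒ jn)

deleteEdge : ∀ {n} → Graph n → Fin n → Fin n → Graph n
deleteEdge H c d = record
  { adj        = λ i j → adj H i j ∧ not (joins c d i j)
  ; adj-sym    = λ i j → cong₂ _∧_ (adj-sym H i j) (cong not (joins-sym c d i j))
  ; adj-irrefl = λ i → cong (_∧ _) (adj-irrefl H i)
  }

deleteEdge-⊆ : ∀ {n} (H : Graph n) c d → deleteEdge H c d ⊆ᴳ H
deleteEdge-⊆ H c d u v h with adj H u v
... | true = refl

deleteEdge-deletes : ∀ {n} (H : Graph n) c d → ¬ Edge (deleteEdge H c d) c d
deleteEdge-deletes H c d h
  rewrite dec-true (c ≟ c) refl | dec-true (d ≟ d) refl | ∧-zeroʳ (adj H c d) with h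
... | ()

ForEdges : ∀ {h} → Graph h → (Fin h → Fin h → Set) → Set
ForEdges H P = ∀ i j → i < j → Edge H i j → P i j

Avoiding : ∀ {h n} → Graph h → (Fin h → Fin n) → (Fin h → Fin h → List (Fin n)) → Fin n → Set
Avoiding H b I v = (∀ k → b k ≢ v) × ForEdges H (λ i j → v ∉ I i j)

module _ {h n} {H : Graph h} {G : Graph n} where

  Avoids : TopEmbedding H G → Fin n → Set
  Avoids e = Avoiding H (branch e) (inner e)

  branch-unique : ∀ (e : TopEmbedding H G) {u a b} → u ≡ branch e a → u ≡ branch e b → a ≡ b
  branch-unique e u≡a u≡b = branch-inj e (trans (sym u≡a) u≡b)

  weakenTarget : ∀ {G′} → G ⊆ᴳ G′ → TopEmbedding H G → TopEmbedding H G′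
  weakenTarget G⊆G′ e = record
    { branch              = branch e
    ; branch-inj          = branch-inj e
    ; inner               = inner e
    ; path-edges          = λ i j i<j ij → Linked.map (G⊆G′ _ _) (path-edges e i j i<j ij)
    ; path-unique         = path-unique e
    ; inner-not-branch    = inner-not-branch e
    ; internally-disjoint = internally-disjoint e
    }

  restrictSource : ∀ {H′} → H′ ⊆ᴳ H → TopEmbedding H G → TopEmbedding H′ G
  restrictSource H′⊆H e = record
    { branch              = branch e
    ; branch-inj          = branch-inj e
    ; inner               = inner e
    ; path-edges          = λ i j i<j ij → path-edges e i j i<j (H′⊆H i j ij)
    ; path-unique         = λ i j i<j ij → path-unique e i j i<j (H′⊆H i j ij)
    ; inner-not-branch    = λ i j i<j ij → inner-not-branch e i j i<j (H′⊆H i j ij)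
    ; internally-disjoint = λ i j k l i<j ij k<l kl →
                              internally-disjoint e i j k l i<j (H′⊆H i j ij) k<l (H′⊆H k l kl)
    }

punchOuts : ∀ {m} → Fin (ℕ.suc m) → List (Fin (ℕ.suc m)) → List (Fin m)
punchOuts v []       = []
punchOuts v (z ∷ zs) with v ≟ z
... | yes _   = punchOuts v zs
... | no v≢z  = punchOut v≢z ∷ punchOuts v zs

module _ {m} (v : Fin (ℕ.suc m)) where

  map-punchIn-punchOuts : ∀ zs → v ∉ zs → map (punchIn v) (punchOuts v zs) ≡ zs
  map-punchIn-punchOuts []       _  = refl
  map-punchIn-punchOuts (z ∷ zs) v∉ with v ≟ z
  ... | yes v≡z = ⊥-elim (v∉ (here v≡z))
  ... | no v≢z  = cong₂ _∷_ (punchIn-punchOut v≢z) (map-punchIn-punchOuts zs (v∉ ∘ there))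

  ∈-punchOuts⁻ : ∀ {z} zs → z ∈ punchOuts v zs → punchIn v z ∈ zs
  ∈-punchOuts⁻ (z′ ∷ zs) z∈ with v ≟ z′ | z∈
  ... | yes _   | z∈′        = there (∈-punchOuts⁻ zs z∈′)
  ... | no v≢z′ | here z≡    = here (trans (cong (punchIn v) z≡) (punchIn-punchOut v≢z′))
  ... | no _    | there z∈′  = there (∈-punchOuts⁻ zs z∈′)

module _ {h m} {H : Graph h} {G : Graph (ℕ.suc m)} where

  deleteAvoidedVertex : ∀ v (e : TopEmbedding H G) → Avoids e v → TopEmbedding H (deleteVertex G v)
  deleteAvoidedVertex v e (∉branch , ∉inner) = record
    { branch              = branch′
    ; branch-inj          = λ {i} {j} eq → branch-inj e (begin
                              branch e i             ≡⟨ branch-punchIn i ⟨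
                              punchIn v (branch′ i)  ≡⟨ cong (punchIn v) eq ⟩
                              punchIn v (branch′ j)  ≡⟨ branch-punchIn j ⟩
                              branch e j             ∎)
    ; inner               = λ i j → punchOuts v (inner e i j)
    ; path-edges          = λ i j i<j ij → Linked.map⁻ (subst (Linked (Edge G))
                              (sym (path-punchIn i j i<j ij)) (path-edges e i j i<j ij))
    ; path-unique         = λ i j i<j ij → Unique.map⁻
                              (subst Unique (sym (path-punchIn i j i<j ij)) (path-unique e i j i<j ij))
    ; inner-not-branch    = λ i j i<j ij z z∈ k z≡ → inner-not-branch e i j i<j ij (punchIn v z)
                              (∈-punchOuts⁻ v _ z∈) k (trans (cong (punchIn v) z≡) (branch-punchIn k))
    ; internally-disjoint = λ i j k l i<j ij k<l kl ne z z∈₁ z∈₂ →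
                              internally-disjoint e i j k l i<j ij k<l kl ne (punchIn v z)
                                (∈-punchOuts⁻ v _ z∈₁) (∈-punchOuts⁻ v _ z∈₂)
    }
    where
    open ≡-Reasoning
    branch′ : Fin h → Fin m
    branch′ k = punchOut (∉branch k ∘ sym)
    branch-punchIn : ∀ k → punchIn v (branch′ k) ≡ branch e k
    branch-punchIn k = punchIn-punchOut (∉branch k ∘ sym)
    path-punchIn : ∀ i j → i < j → Edge H i j →
                   map (punchIn v) (branch′ i ∷ punchOuts v (inner e i j) ++ [ branch′ j ]) ≡ pathOf e i j
    path-punchIn i j i<j ij = begin
      punchIn v (branch′ i) ∷ map (punchIn v) (punchOuts v (inner e i j) ++ [ branch′ j ])
        ≡⟨ cong (_ ∷_) (map-++ (punchIn v) (punchOuts v (inner e i j)) [ branch′ j ]) ⟩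
      punchIn v (branch′ i) ∷ map (punchIn v) (punchOuts v (inner e i j)) ++ [ punchIn v (branch′ j) ]
        ≡⟨ cong₂ (λ x I → x ∷ I ++ [ punchIn v (branch′ j) ]) (branch-punchIn i)
                 (map-punchIn-punchOuts v (inner e i j) (∉inner i j i<j ij)) ⟩
      branch e i ∷ inner e i j ++ [ punchIn v (branch′ j) ]
        ≡⟨ cong (λ x → branch e i ∷ inner e i j ++ [ x ]) (branch-punchIn j) ⟩
      pathOf e i j ∎

avoids⇒properK4 : ∀ {n} {G : Graph n} {v} (e : TopEmbedding K4 G) → Avoids e v → HasProperK4Subdivision G
avoids⇒properK4 {ℕ.zero}  {v = ()}
avoids⇒properK4 {ℕ.suc _} {v = v} e avoids = v , deleteAvoidedVertex v e avoids

module _ {h n} {H : Graph h} {G : Graph n} where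

  addBranchEdge : ∀ (e : TopEmbedding H G) p q → Edge G (branch e p) (branch e q) →
                  TopEmbedding (addEdge H p q) G
  addBranchEdge e p q pq = record
    { branch              = branch e
    ; branch-inj          = branch-inj e
    ; inner               = inner′
    ; path-edges          = edges
    ; path-unique         = unique
    ; inner-not-branch    = notBranch
    ; internally-disjoint = disjoint
    }
    where
    inner′ : Fin h → Fin h → List (Fin n)
    inner′ i j = if adj H i j then inner e i j else []

    path′ : Fin h → Fin h → List (Fin n)
    path′ i j = branch e i ∷ inner′ i j ++ [ branch e j ]

    edges : ForEdges (addEdge H p q) (λ i j → Linked (Edge G) (path′ i j))
    edges i j i<j ij with adj H i j in old | addEdge-edge H p q ij
    ... | true  | _                         = path-edges e i j i<j old
    ... | false | inj₂ (inj₁ (refl , refl)) = pq ∷ [-]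
    ... | false | inj₂ (inj₂ (refl , refl)) = Edge-sym G pq ∷ [-]

    unique : ForEdges (addEdge H p q) (λ i j → Unique (path′ i j))
    unique i j i<j ij with adj H i j in old
    ... | true  = path-unique e i j i<j old
    ... | false = ((λ bi≡bj → <-irrefl (branch-inj e bi≡bj) i<j) ∷ []) ∷ [] ∷ []

    notBranch : ForEdges (addEdge H p q) (λ i j → ∀ v → v ∈ inner′ i j → ∀ k → v ≢ branch e k)
    notBranch i j i<j ij with adj H i j in old
    ... | true = inner-not-branch e i j i<j old

    disjoint : ∀ i j k l → i < j → Edge (addEdge H p q) i j → k < l → Edge (addEdge H p q) k l →
               ¬ (i ≡ k × j ≡ l) → ∀ v → v ∈ inner′ i j → v ∉ inner′ k l
    disjoint i j k l i<j _ k<l _ ne v with adj H i j in old₁ | adj H k l in old₂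
    ... | true | true = internally-disjoint e i j k l i<j old₁ k<l old₂ ne v
    ... | true | false = λ _ ()

-- Composition of topological embeddings

module Expansion {k n} {K : Graph k} {G : Graph n} (g : TopEmbedding K G) where

  IsInner : Fin n → Fin k → Fin k → Set
  IsInner z s t = s < t × Edge K s t × z ∈ inner g s t

  IsInner-unique : ∀ {z s t s′ t′} → IsInner z s t → IsInner z s′ t′ → s ≡ s′ × t ≡ t′
  IsInner-unique {z} {s} {t} {s′} {t′} (s<t , st , z∈) (s′<t′ , s′t′ , z∈′) with s ≟ s′ | t ≟ t′
  ... | yes s≡s′ | yes t≡t′ = s≡s′ , t≡t′
  ... | no s≢s′  | _        =
        ⊥-elim (internally-disjoint g s t s′ t′ s<t st s′<t′ s′t′ (s≢s′ ∘ proj₁) z z∈ z∈′)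
  ... | yes _    | no t≢t′  =
        ⊥-elim (internally-disjoint g s t s′ t′ s<t st s′<t′ s′t′ (t≢t′ ∘ proj₂) z z∈ z∈′)

  IsInner-notBranch : ∀ {z s t} → IsInner z s t → ∀ u → z ≢ branch g u
  IsInner-notBranch (s<t , st , z∈) = inner-not-branch g _ _ s<t st _ z∈

  InnerOfEdgeIn : Fin n → List (Fin k) → Set
  InnerOfEdgeIn z W = ∃₂ λ s t → IsInner z s t × s ∈ W × t ∈ W

  -- The g-path from branch a to branch b, read backwards when b < a (junk [] when a ≡ b).
  segment : Fin k → Fin k → List (Fin n)
  segment a b with <-cmp a b
  ... | tri< _ _ _ = inner g a b
  ... | tri≈ _ _ _ = []
  ... | tri> _ _ _ = reverse (inner g b a)

  segment-linked : ∀ {a b} → Edge K a b → Linked (Edge G) (branch g a ∷ segment a b ++ [ branch g b ])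
  segment-linked {a} {b} ab with <-cmp a b
  ... | tri< a<b _ _ = path-edges g a b a<b ab
  ... | tri≈ _ refl _ = ⊥-elim (Edge-irrefl K ab)
  ... | tri> _ _ b<a = subst (Linked (Edge G)) (reverse-path (branch g b) (inner g b a) (branch g a))
                         (Linked-reverse (Edge-sym G) (path-edges g b a b<a (Edge-sym K ab)))

  segment-unique : ∀ {a b} → Edge K a b → Unique (branch g a ∷ segment a b ++ [ branch g b ])
  segment-unique {a} {b} ab with <-cmp a b
  ... | tri< a<b _ _ = path-unique g a b a<b ab
  ... | tri≈ _ refl _ = ⊥-elim (Edge-irrefl K ab)
  ... | tri> _ _ b<a = subst Unique (reverse-path (branch g b) (inner g b a) (branch g a))
                         (Unique-reverse (path-unique g b a b<a (Edge-sym K ab)))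

  segment-inner : ∀ {a b z} → Edge K a b → z ∈ segment a b → IsInner z a b ⊎ IsInner z b a
  segment-inner {a} {b} ab z∈ with <-cmp a b
  ... | tri< a<b _ _ = inj₁ (a<b , ab , z∈)
  ... | tri≈ _ refl _ = ⊥-elim (Edge-irrefl K ab)
  ... | tri> _ _ b<a = inj₂ (b<a , Edge-sym K ab , Any.reverse⁻ z∈)

  interior : Fin k → List (Fin k) → Fin k → List (Fin n)
  interior a []       b = segment a b
  interior a (c ∷ cs) b = segment a c ++ branch g c ∷ interior c cs b

  -- The image of the K-walk a ∷ cs ++ [ b ] under g: every step is replaced by its segment.
  route : Fin k → List (Fin k) → Fin k → List (Fin n)
  route a cs b = branch g a ∷ interior a cs b ++ [ branch g b ]

  route-∷ : ∀ a c cs b → route a (c ∷ cs) b ≡ (branch g a ∷ segment a c) ++ route c cs b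
  route-∷ a c cs b = cong (branch g a ∷_) (++-assoc (segment a c) (branch g c ∷ interior c cs b) _)

  route-linked : ∀ {a} cs {b} → Linked (Edge K) (a ∷ cs ++ [ b ]) → Linked (Edge G) (route a cs b)
  route-linked []       (ab ∷ [-])  = segment-linked ab
  route-linked {a} (c ∷ cs) {b} (ac ∷ rest) = subst (Linked (Edge G)) (sym (route-∷ a c cs b))
    (Linked-join (branch g a ∷ segment a c) (segment-linked ac) (route-linked cs rest))

  interior-location : ∀ {a} cs {b z} → Linked (Edge K) (a ∷ cs ++ [ b ]) → z ∈ interior a cs b →
                      (∃ λ u → u ∈ cs × z ≡ branch g u) ⊎ InnerOfEdgeIn z (a ∷ cs ++ [ b ])
  interior-location [] (ab ∷ [-]) z∈ with segment-inner ab z∈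
  ... | inj₁ z-ab = inj₂ (_ , _ , z-ab , here refl , there (here refl))
  ... | inj₂ z-ba = inj₂ (_ , _ , z-ba , there (here refl) , here refl)
  interior-location {a} (c ∷ cs) {b} (ac ∷ rest) z∈
    with ∈-++⁻ (segment a c) {branch g c ∷ interior c cs b} z∈
  ... | inj₁ z∈seg with segment-inner ac z∈seg
  ...   | inj₁ z-ac = inj₂ (_ , _ , z-ac , here refl , there (here refl))
  ...   | inj₂ z-ca = inj₂ (_ , _ , z-ca , there (here refl) , here refl)
  interior-location (c ∷ cs) (ac ∷ rest) z∈ | inj₂ (here z≡) = inj₁ (c , here refl , z≡)
  interior-location (c ∷ cs) (ac ∷ rest) z∈ | inj₂ (there z∈′) with interior-location cs rest z∈′
  ... | inj₁ (u , u∈ , z≡)            = inj₁ (u , there u∈ , z≡)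
  ... | inj₂ (s , t , z-st , s∈ , t∈) = inj₂ (s , t , z-st , there s∈ , there t∈)

  route-location : ∀ {a} cs {b z} → Linked (Edge K) (a ∷ cs ++ [ b ]) → z ∈ route a cs b →
                   (∃ λ u → u ∈ a ∷ cs ++ [ b ] × z ≡ branch g u) ⊎ InnerOfEdgeIn z (a ∷ cs ++ [ b ])
  route-location cs walk (here z≡) = inj₁ (_ , here refl , z≡)
  route-location {a} cs {b} walk (there z∈) with ∈-++⁻ (interior a cs b) z∈
  ... | inj₂ (here z≡) = inj₁ (b , there (∈-++⁺ʳ cs (here refl)) , z≡)
  ... | inj₁ z∈′ with interior-location cs walk z∈′
  ...   | inj₁ (u , u∈ , z≡) = inj₁ (u , there (∈-++⁺ˡ u∈) , z≡)
  ...   | inj₂ inner         = inj₂ inner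

  route-unique : ∀ {a} cs {b} → Linked (Edge K) (a ∷ cs ++ [ b ]) → Unique (a ∷ cs ++ [ b ]) →
                 Unique (route a cs b)
  route-unique []       (ab ∷ [-])  _ = segment-unique ab
  route-unique {a} (c ∷ cs) {b} (ac ∷ rest) (a∉ ∷ distinct) = subst Unique (sym (route-∷ a c cs b))
    (Unique.++⁺ (Unique-++⁻ˡ (branch g a ∷ segment a c) (segment-unique ac))
                (route-unique cs rest distinct) disjoint)
    where
    a∉rest : a ∉ c ∷ cs ++ [ b ]
    a∉rest a∈ = All.lookup a∉ a∈ refl
    disjoint : ∀ {z} → ¬ (z ∈ branch g a ∷ segment a c × z ∈ route c cs b)
    disjoint (here z≡a , z∈) with route-location cs rest z∈
    ... | inj₁ (u , u∈ , z≡u)     = a∉rest (subst (_∈ _) (sym (branch-unique g z≡a z≡u)) u∈)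
    ... | inj₂ (_ , _ , z-st , _) = IsInner-notBranch z-st a z≡a
    disjoint (there z∈seg , z∈) with segment-inner ac z∈seg | route-location cs rest z∈
    ... | inj₁ z-ac | inj₁ (u , _ , z≡u) = IsInner-notBranch z-ac u z≡u
    ... | inj₂ z-ca | inj₁ (u , _ , z≡u) = IsInner-notBranch z-ca u z≡u
    ... | inj₁ z-ac | inj₂ (_ , _ , z-st , s∈ , _) =
          a∉rest (subst (_∈ _) (sym (proj₁ (IsInner-unique z-ac z-st))) s∈)
    ... | inj₂ z-ca | inj₂ (_ , _ , z-st , _ , t∈) =
          a∉rest (subst (_∈ _) (sym (proj₂ (IsInner-unique z-ca z-st))) t∈)

module _ {h k} {H : Graph h} {K : Graph k} (f : TopEmbedding H K) where

  Endpoint : Fin h → Fin h → Fin k → Set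
  Endpoint i j u = u ≡ branch f i ⊎ u ≡ branch f j

  path-vertex : ∀ {i j u} → u ∈ pathOf f i j → Endpoint i j u ⊎ u ∈ inner f i j
  path-vertex         (here u≡)  = inj₁ (inj₁ u≡)
  path-vertex {i} {j} (there u∈) with ∈-++⁻ (inner f i j) u∈
  ... | inj₁ u∈I       = inj₂ u∈I
  ... | inj₂ (here u≡) = inj₁ (inj₂ u≡)

  shared⇒endpoint : ∀ {i j k l u} → i < j → Edge H i j → k < l → Edge H k l → ¬ (i ≡ k × j ≡ l) →
                    u ∈ pathOf f i j → u ∈ pathOf f k l → Endpoint i j u
  shared⇒endpoint {i} {j} {k} {l} {u} i<j ij k<l kl ne u∈ u∈′ with path-vertex u∈ | path-vertex u∈′
  ... | inj₁ end           | _                  = end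
  ... | inj₂ u∈I | inj₁ (inj₁ u≡) = ⊥-elim (inner-not-branch f i j i<j ij u u∈I k u≡)
  ... | inj₂ u∈I | inj₁ (inj₂ u≡) = ⊥-elim (inner-not-branch f i j i<j ij u u∈I l u≡)
  ... | inj₂ u∈I | inj₂ u∈I′      = ⊥-elim (internally-disjoint f i j k l i<j ij k<l kl ne u u∈I u∈I′)

  distinct-endpoints : ∀ {i j s t} → s ≢ t → Endpoint i j s → Endpoint i j t →
                       (s ≡ branch f i × t ≡ branch f j) ⊎ (s ≡ branch f j × t ≡ branch f i)
  distinct-endpoints s≢t (inj₁ s≡) (inj₁ t≡) = ⊥-elim (s≢t (trans s≡ (sym t≡)))
  distinct-endpoints s≢t (inj₁ s≡) (inj₂ t≡) = inj₁ (s≡ , t≡)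
  distinct-endpoints s≢t (inj₂ s≡) (inj₁ t≡) = inj₂ (s≡ , t≡)
  distinct-endpoints s≢t (inj₂ s≡) (inj₂ t≡) = ⊥-elim (s≢t (trans s≡ (sym t≡)))

  common-endpoints⇒same-edge : ∀ {i j k l s t} → i < j → k < l → s ≢ t →
    Endpoint i j s → Endpoint i j t → Endpoint k l s → Endpoint k l t → i ≡ k × j ≡ l
  common-endpoints⇒same-edge i<j k<l s≢t s-ij t-ij s-kl t-kl
    with distinct-endpoints s≢t s-ij t-ij | distinct-endpoints s≢t s-kl t-kl
  ... | inj₁ (s≡i , t≡j) | inj₁ (s≡k , t≡l) = branch-unique f s≡i s≡k , branch-unique f t≡j t≡l
  ... | inj₂ (s≡j , t≡i) | inj₂ (s≡l , t≡k) = branch-unique f t≡i t≡k , branch-unique f s≡j s≡l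
  ... | inj₁ (s≡i , t≡j) | inj₂ (s≡l , t≡k) =
        ⊥-elim (<-asym i<j (subst₂ _<_ (branch-unique f t≡k t≡j) (branch-unique f s≡l s≡i) k<l))
  ... | inj₂ (s≡j , t≡i) | inj₁ (s≡k , t≡l) =
        ⊥-elim (<-asym i<j (subst₂ _<_ (branch-unique f s≡k s≡j) (branch-unique f t≡l t≡i) k<l))

module _ {h k n} {H : Graph h} {K : Graph k} {G : Graph n} where

  infixr 9 _∘ᵀ_
  _∘ᵀ_ : TopEmbedding K G → TopEmbedding H K → TopEmbedding H G
  g ∘ᵀ f = record
    { branch              = branch g ∘ branch f
    ; branch-inj          = branch-inj f ∘ branch-inj g
    ; inner               = λ i j → interior (branch f i) (inner f i j) (branch f j)
    ; path-edges          = λ i j i<j ij → route-linked (inner f i j) (path-edges f i j i<j ij)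
    ; path-unique         = λ i j i<j ij → route-unique (inner f i j) (path-edges f i j i<j ij)
                                                        (path-unique f i j i<j ij)
    ; inner-not-branch    = notBranch
    ; internally-disjoint = disjoint
    }
    where
    open Expansion g

    notBranch : ∀ i j → i < j → Edge H i j → ∀ z → z ∈ interior (branch f i) (inner f i j) (branch f j) →
                ∀ m → z ≢ branch g (branch f m)
    notBranch i j i<j ij z z∈ m z≡m with interior-location (inner f i j) (path-edges f i j i<j ij) z∈
    ... | inj₁ (u , u∈ , z≡u)     = inner-not-branch f i j i<j ij u u∈ m (branch-unique g z≡u z≡m)
    ... | inj₂ (_ , _ , z-st , _) = IsInner-notBranch z-st (branch f m) z≡m

    disjoint : ∀ i j k l → i < j → Edge H i j → k < l → Edge H k l → ¬ (i ≡ k × j ≡ l) → ∀ z →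
               z ∈ interior (branch f i) (inner f i j) (branch f j) →
               z ∉ interior (branch f k) (inner f k l) (branch f l)
    disjoint i j k l i<j ij k<l kl ne z z∈₁ z∈₂
      with interior-location (inner f i j) (path-edges f i j i<j ij) z∈₁
         | interior-location (inner f k l) (path-edges f k l k<l kl) z∈₂
    ... | inj₁ (u , u∈ , z≡u) | inj₁ (u′ , u′∈ , z≡u′) =
          internally-disjoint f i j k l i<j ij k<l kl ne u u∈ (subst (_∈ _) (branch-unique g z≡u′ z≡u) u′∈)
    ... | inj₁ (u , _ , z≡u) | inj₂ (_ , _ , z-st , _) = IsInner-notBranch z-st u z≡u
    ... | inj₂ (_ , _ , z-st , _) | inj₁ (u , _ , z≡u) = IsInner-notBranch z-st u z≡u
    ... | inj₂ (s , t , z-st , s∈ , t∈) | inj₂ (_ , _ , z-st′ , s∈′ , t∈′)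
      with IsInner-unique z-st′ z-st
    -- Both f-paths traverse the K-edge st; distinct f-paths share only branch vertices, so s and t
    -- are the ends of both, which makes them the same H-edge.
    ... | refl , refl = ne (common-endpoints⇒same-edge f i<j k<l (λ s≡t → <-irrefl s≡t (proj₁ z-st))
          (shared⇒endpoint f i<j ij k<l kl ne s∈ s∈′) (shared⇒endpoint f i<j ij k<l kl ne t∈ t∈′)
          (shared⇒endpoint f k<l kl i<j ij ne′ s∈′ s∈) (shared⇒endpoint f k<l kl i<j ij ne′ t∈′ t∈))
      where
      ne′ : ¬ (k ≡ i × l ≡ j)
      ne′ (k≡i , l≡j) = ne (sym k≡i , sym l≡j)

  ∘ᵀ-avoids : ∀ (g : TopEmbedding K G) (f : TopEmbedding H K) {v} → Avoids g v → Avoids (g ∘ᵀ f) v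
  ∘ᵀ-avoids g f (∉branch , ∉inner) = (λ m → ∉branch (branch f m)) , ∉interior
    where
    open Expansion g
    ∉interior : ∀ i j → i < j → Edge H i j → _ ∉ interior (branch f i) (inner f i j) (branch f j)
    ∉interior i j i<j ij v∈ with interior-location (inner f i j) (path-edges f i j i<j ij) v∈
    ... | inj₁ (u , _ , v≡u)                     = ∉branch u (sym v≡u)
    ... | inj₂ (s , t , (s<t , st , v∈st) , _)   = ∉inner s t s<t st v∈st

  ∘ᵀ-avoids-branch : ∀ (g : TopEmbedding K G) (f : TopEmbedding H K) {r} → Avoids f r →
                     Avoids (g ∘ᵀ f) (branch g r)
  ∘ᵀ-avoids-branch g f {r} (∉branch , ∉inner) = (λ m eq → ∉branch m (branch-inj g eq)) , ∉interior
    where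
    open Expansion g
    ∉interior : ∀ i j → i < j → Edge H i j → branch g r ∉ interior (branch f i) (inner f i j) (branch f j)
    ∉interior i j i<j ij r∈ with interior-location (inner f i j) (path-edges f i j i<j ij) r∈
    ... | inj₁ (u , u∈ , r≡u)     = ∉inner i j i<j ij (subst (_∈ _) (sym (branch-unique g refl r≡u)) u∈)
    ... | inj₂ (_ , _ , r-st , _) = IsInner-notBranch r-st r refl

-- Deciding topological embeddings between concrete graphs

forEdges? : ∀ {h} (H : Graph h) {P : Fin h → Fin h → Set} → (∀ i j → Dec (P i j)) → Dec (ForEdges H P)
forEdges? H P? = all? λ i → all? λ j → (i <? j) →-dec (adj H i j ≟ᵇ true) →-dec P? i j

module _ {h n} (H : Graph h) (b : Fin h → Fin n) (I : Fin h → Fin h → List (Fin n)) where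

  open import Data.List.Membership.DecPropositional (_≟_ {n}) using (_∉?_)

  avoiding? : ∀ v → Dec (Avoiding H b I v)
  avoiding? v = (all? λ k → ¬? (b k ≟ v)) ×-dec forEdges? H (λ i j → v ∉? I i j)

module _ {h n} (H : Graph h) (G : Graph n) (b : Fin h → Fin n) (I : Fin h → Fin h → List (Fin n)) where

  open import Data.List.Relation.Unary.Unique.DecPropositional (_≟_ {n}) using (unique?)
  open import Data.List.Membership.DecPropositional (_≟_ {n}) using (_∉?_)

  private
    path : Fin h → Fin h → List (Fin n)
    path i j = b i ∷ I i j ++ [ b j ]

  IsTopEmbedding : Set
  IsTopEmbedding = (∀ i j → b i ≡ b j → i ≡ j)
                 × ForEdges H (λ i j → Linked (Edge G) (path i j) × Unique (path i j)
                                       × All (λ v → ∀ k → v ≢ b k) (I i j))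
                 × ForEdges H (λ i j → ForEdges H (λ k l → ¬ (i ≡ k × j ≡ l) → All (_∉ I k l) (I i j)))

  isTopEmbedding? : Dec IsTopEmbedding
  isTopEmbedding? =
        (all? λ i → all? λ j → (b i ≟ b j) →-dec (i ≟ j))
    ×-dec forEdges? H (λ i j → Linked.linked? (λ u v → adj G u v ≟ᵇ true) (path i j)
                                ×-dec unique? (path i j)
                                ×-dec All.all? (λ v → all? λ k → ¬? (v ≟ b k)) (I i j))
    ×-dec forEdges? H (λ i j → forEdges? H (λ k l → ¬? ((i ≟ k) ×-dec (j ≟ l))
                                                    →-dec All.all? (_∉? I k l) (I i j)))

  toTopEmbedding : IsTopEmbedding → TopEmbedding H G
  toTopEmbedding (inj , paths , disjoint) = record
    { branch              = b
    ; branch-inj          = inj _ _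
    ; inner               = I
    ; path-edges          = λ i j i<j ij → proj₁ (paths i j i<j ij)
    ; path-unique         = λ i j i<j ij → proj₁ (proj₂ (paths i j i<j ij))
    ; inner-not-branch    = λ i j i<j ij v v∈ → All.lookup (proj₂ (proj₂ (paths i j i<j ij))) v∈
    ; internally-disjoint = λ i j k l i<j ij k<l kl ne v v∈ →
                              All.lookup (disjoint i j i<j ij k l k<l kl ne) v∈
    }

-- K₄ in K₃,₃ − cd and in K₃,₃ + pq

sideMates : Fin 6 → Fin 6 × Fin 6
sideMates 0F = 1F , 2F
sideMates 1F = 0F , 2F
sideMates 2F = 0F , 1F
sideMates 3F = 4F , 5F
sideMates 4F = 3F , 5F
sideMates 5F = 3F , 4F

opposite : Fin 6 → Fin 6
opposite 0F = 3F
opposite 1F = 4F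
opposite 2F = 5F
opposite 3F = 0F
opposite 4F = 1F
opposite 5F = 2F

third : Fin 6 → Fin 6 → Fin 6
third p q = if does (q ≟ proj₁ (sideMates p)) then proj₂ (sideMates p) else proj₁ (sideMates p)

corners : ∀ {n} → Fin n → Fin n → Fin n → Fin n → Fin 4 → Fin n
corners w₀ w₁ w₂ w₃ 0F = w₀
corners w₀ w₁ w₂ w₃ 1F = w₁
corners w₀ w₁ w₂ w₃ 2F = w₂
corners w₀ w₁ w₂ w₃ 3F = w₃

detours : ∀ {n} → List (Fin n) → List (Fin n) → Fin 4 → Fin 4 → List (Fin n)
detours P Q 0F 1F = P
detours P Q 2F 3F = Q
detours P Q _  _  = []

-- For an edge cd, the other four vertices form a 4-cycle of K₃,₃ − cd whose two diagonals are
-- routed through d and c.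
module DeletedEdge (c d : Fin 6) where
  corner : Fin 4 → Fin 6
  corner = corners (proj₁ (sideMates c)) (proj₂ (sideMates c))
                   (proj₁ (sideMates d)) (proj₂ (sideMates d))
  paths : Fin 4 → Fin 4 → List (Fin 6)
  paths = detours [ d ] [ c ]

-- For p, q on one side: p, q and two vertices of the other side, the latter two joined through
-- the third vertex of p's side; the remaining vertex, opposite p, is avoided.
module AddedEdge (p q : Fin 6) where
  corner : Fin 4 → Fin 6
  corner = corners p q (proj₁ (sideMates (opposite p))) (proj₂ (sideMates (opposite p)))
  paths : Fin 4 → Fin 4 → List (Fin 6)
  paths = detours [] [ third p q ]

K4⊆K33-deleteEdge : ForEdges K33 λ c d →
                    IsTopEmbedding K4 (deleteEdge K33 c d) (DeletedEdge.corner c d) (DeletedEdge.paths c d)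
K4⊆K33-deleteEdge = toWitness {a? = forEdges? K33 λ c d →
  isTopEmbedding? K4 (deleteEdge K33 c d) (DeletedEdge.corner c d) (DeletedEdge.paths c d)} tt

K4⊆K33-addEdge : ∀ p q → p ≢ q → ¬ Edge K33 p q →
                 IsTopEmbedding K4 (addEdge K33 p q) (AddedEdge.corner p q) (AddedEdge.paths p q)
                 × Avoiding K4 (AddedEdge.corner p q) (AddedEdge.paths p q) (opposite p)
K4⊆K33-addEdge = toWitness {a? = all? λ p → all? λ q → ¬? (p ≟ q) →-dec ¬? (adj K33 p q ≟ᵇ true) →-dec
  (isTopEmbedding? K4 (addEdge K33 p q) (AddedEdge.corner p q) (AddedEdge.paths p q)
   ×-dec avoiding? K4 (AddedEdge.corner p q) (AddedEdge.paths p q) (opposite p))} tt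

restrictSource-avoids : ∀ {h n} {H H′ : Graph h} {G : Graph n} (e : TopEmbedding H G) (H′⊆H : H′ ⊆ᴳ H)
  {c d v} → c < d → Edge H c d → ¬ Edge H′ c d → v ∈ inner e c d →
  Avoids (restrictSource {H′ = H′} H′⊆H e) v
restrictSource-avoids {H′ = H′} e H′⊆H {c} {d} {v} c<d cd c≁d v∈ =
  (λ k v≡ → inner-not-branch e c d c<d cd v v∈ k (sym v≡)) , ∉inner
  where
  open Expansion e
  ∉inner : ∀ s t → s < t → Edge H′ s t → v ∉ inner e s t
  ∉inner s t s<t st v∈st with IsInner-unique (s<t , H′⊆H s t st , v∈st) (c<d , cd , v∈)
  ... | refl , refl = c≁d st

innerVertex⇒properK4 : ∀ {n} {S G : Graph n} (e : TopEmbedding K33 S) → S ⊆ᴳ G →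
                       ∀ {c d v} → c < d → Edge K33 c d → v ∈ inner e c d → HasProperK4Subdivision G
innerVertex⇒properK4 {G = G} e S⊆G {c} {d} {v} c<d cd v∈ =
  avoids⇒properK4 (g ∘ᵀ f) (∘ᵀ-avoids g f g-avoids)
  where
  g : TopEmbedding (deleteEdge K33 c d) G
  g = restrictSource (deleteEdge-⊆ K33 c d) (weakenTarget S⊆G e)

  g-avoids : Avoids g v
  g-avoids = restrictSource-avoids {H′ = deleteEdge K33 c d} (weakenTarget {G′ = G} S⊆G e)
                                   (deleteEdge-⊆ K33 c d) c<d cd (deleteEdge-deletes K33 c d) v∈

  f : TopEmbedding K4 (deleteEdge K33 c d)
  f = toTopEmbedding K4 (deleteEdge K33 c d) _ _ (K4⊆K33-deleteEdge c d c<d cd)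

sameSideEdge⇒properK4 : ∀ {n} {G : Graph n} (e : TopEmbedding K33 G) {p q} → p ≢ q → ¬ Edge K33 p q →
                      Edge G (branch e p) (branch e q) → HasProperK4Subdivision G
sameSideEdge⇒properK4 {G = G} e {p} {q} p≢q p≁q pq =
  avoids⇒properK4 (g ∘ᵀ f) (∘ᵀ-avoids-branch g f f-avoids)
  where
  g : TopEmbedding (addEdge K33 p q) G
  g = addBranchEdge e p q pq

  f : TopEmbedding K4 (addEdge K33 p q)
  f = toTopEmbedding K4 (addEdge K33 p q) _ _ (proj₁ (K4⊆K33-addEdge p q p≢q p≁q))

  f-avoids : Avoids f (opposite p)
  f-avoids = proj₂ (K4⊆K33-addEdge p q p≢q p≁q)

nonadjacent-ends⇒inner : ∀ {h n} {H : Graph h} {S : Graph n} (e : TopEmbedding H S) {i j} →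
                         i < j → Edge H i j → ¬ Edge S (branch e i) (branch e j) → ∃ λ v → v ∈ inner e i j
nonadjacent-ends⇒inner e {i} {j} i<j ij i≁j with inner e i j | path-edges e i j i<j ij
... | []    | ij′ ∷ [-] = ⊥-elim (i≁j ij′)
... | v ∷ _ | _         = v , here refl

branchEdge⇒properK4 : ∀ {n} {S G : Graph n} (e : TopEmbedding K33 S) → S ⊆ᴳ G → ∀ {p q} → p ≢ q →
                      ¬ Edge S (branch e p) (branch e q) → Edge G (branch e p) (branch e q) →
                      HasProperK4Subdivision G
branchEdge⇒properK4 {S = S} {G} e S⊆G {p} {q} p≢q p≁q pq with adj K33 p q in K-pq | <-cmp p q
... | false | _ = sameSideEdge⇒properK4 (weakenTarget {G′ = G} S⊆G e) p≢q
                    (λ K-pq′ → case trans (sym K-pq) K-pq′ of λ ()) pq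
... | true | tri≈ _ p≡q _ = ⊥-elim (p≢q p≡q)
... | true | tri< p<q _ _ =
  innerVertex⇒properK4 e S⊆G p<q K-pq (proj₂ (nonadjacent-ends⇒inner e p<q K-pq p≁q))
... | true | tri> _ _ q<p =
  innerVertex⇒properK4 e S⊆G q<p K-qp (proj₂ (nonadjacent-ends⇒inner e q<p K-qp (p≁q ∘ Edge-sym S)))
  where
  K-qp : Edge K33 q p
  K-qp = Edge-sym K33 {p} {q} K-pq

mainTheorem14 : ∀ {n} (S G : Graph n) → IsSubdivisionOf S K33 →
                (x y : Fin n) → x ≢ y → ¬ Edge S x y →
                (∀ u v → Edge G u v ⇔ (Edge S u v ⊎ ((u ≡ x × v ≡ y) ⊎ (u ≡ y × v ≡ x)))) →
                HasProperK4Subdivision G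
mainTheorem14 {n} S G (e , covered , _) x y x≢y x≁y G≡S+xy = byCases (covered x) (covered y)
  where
  Location : Fin n → Set
  Location v = (∃ λ k → v ≡ branch e k) ⊎ (∃ λ i → ∃ λ j → i < j × Edge K33 i j × v ∈ inner e i j)

  S⊆G : S ⊆ᴳ G
  S⊆G u v uv = Equivalence.from (G≡S+xy u v) (inj₁ uv)

  xy : Edge G x y
  xy = Equivalence.from (G≡S+xy x y) (inj₂ (inj₁ (refl , refl)))

  byCases : Location x → Location y → HasProperK4Subdivision G
  byCases (inj₂ (c , d , c<d , cd , x∈)) _ = innerVertex⇒properK4 e S⊆G c<d cd x∈
  byCases _ (inj₂ (c , d , c<d , cd , y∈)) = innerVertex⇒properK4 e S⊆G c<d cd y∈
  byCases (inj₁ (p , x≡p)) (inj₁ (q , y≡q)) =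
    branchEdge⇒properK4 e S⊆G (λ p≡q → x≢y (trans x≡p (trans (cong (branch e) p≡q) (sym y≡q))))
      (subst₂ (λ u w → ¬ Edge S u w) x≡p y≡q x≁y) (subst₂ (Edge G) x≡p y≡q xy)
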